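{- Let $n\ge1$, let $e$ be an integer-valued function on the positive divisors of $n$, and for $k\in\mathbb Z$ set $m(k)=\sum_{d\mid (k,n)}e(n/d)$ and $p(k)=\sum_{d\mid(k,n)}d\,e(d)$. Let $G(s)=\sum_{k\ge1}g(k)k^{ -s}$ be a formal Dirichlet series with complex coefficients, and define sequences $m^*_G(k)$, $p^*_G(k)$ ($k\ge1$) by the identities of formal Dirichlet series $$\sum_{k\ge1}\frac{m^*_G(k)}{k^s}=G(s)\sum_{d\mid n}\frac{e(d)}{d^s},\qquad \sum_{k\ge1}\frac{p^*_G(k)}{k^s}=G(s)\sum_{d\mid n}\frac{d\,e(n/d)}{d^s}.$$ Then, in the ring of formal Dirichlet series, $$G(s)\sum_{d\mid n}m\Big(\frac nd\Big)\phi_{ -s}(d)=\sum_{k\ge1}\frac{m^*_G(k)}{k^s},\qquad \frac1nG(s)\sum_{d\mid n}p\Big(\frac nd\Big)\phi_{2-s}(d)=\sum_{k\ge1}\frac{p^*_G(k)}{k^s}.$$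
   Context: $(k,n)$ is the greatest common divisor, with $(0,n)=n$. For a positive integer $d$, $\phi_{t-s}(d)=\sum_{d'\mid d}\mu(d/d')\,d'^{\,t}\,d'^{ -s}$ (a finite Dirichlet series), where $\mu$ is the Möbius function. -}

module Defs where

open import Level using (Level)
open import Data.Bool using (Bool; true; false; if_then_else_; _∧_)
open import Data.Nat as ℕ using (ℕ; zero; suc)
open import Data.Nat.Divisibility using (_∣?_)
open import Data.Nat.Primality using (prime?)
open import Data.Nat.GCD using (gcd)
open import Data.Integer as ℤ using (ℤ; +_; -[1+_]; ∣_∣)
open import Data.List using (List; []; _∷_; map; filterᵇ; applyUpTo; length; foldr)
open import Data.Bool.ListAction using (any)
open import Relation.Nullary using (does)
open import Algebra.Bundles using (CommutativeRing)

posUpTo : ℕ → List ℕ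
posUpTo k = applyUpTo suc k

divisors : ℕ → List ℕ
divisors k = filterᵇ (λ d → does (d ∣? k)) (posUpTo k)

-- Total natural-number division; only ever applied with a positive divisor.
quot : ℕ → ℕ → ℕ
quot a zero    = zero
quot a (suc b) = a ℕ./ suc b

Σℤ : List ℕ → (ℕ → ℤ) → ℤ
Σℤ xs f = foldr (λ x acc → f x ℤ.+ acc) (+ 0) xs

μ : ℕ → ℤ
μ zero = + 0
μ k@(suc _) =
  if any (λ p → does (prime? p) ∧ does ((p ℕ.* p) ∣? k)) (posUpTo k)
  then + 0
  else (-[1+ 0 ]) ℤ.^ length (filterᵇ (λ p → does (prime? p) ∧ does (p ∣? k)) (posUpTo k))

-- Formal Dirichlet series with coefficients in A: k ↦ coefficient of k^{-s}
-- (only indices k ≥ 1 are meaningful).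
DS : ∀ {a} → Set a → Set a
DS A = ℕ → A

-- The monomial c · d^{-s} as an integer Dirichlet series.
mono : ℤ → ℕ → DS ℤ
mono c d j = if does (d ℕ.≟ j) then c else + 0

-- φ_{t-s}(d) = Σ_{d' ∣ d} μ(d/d') d'^t d'^{-s}.
φ : ℕ → ℕ → DS ℤ
φ t d j = Σℤ (divisors d) (λ d' → mono (μ (quot d d') ℤ.* (+ (d' ℕ.^ t))) d' j)

mfun : (n : ℕ) → (ℕ → ℤ) → ℤ → ℤ
mfun n e k = Σℤ (divisors (gcd ∣ k ∣ n)) (λ d → e (quot n d))

pfun : (n : ℕ) → (ℕ → ℤ) → ℤ → ℤ
pfun n e k = Σℤ (divisors (gcd ∣ k ∣ n)) (λ d → (+ d) ℤ.* e d)

Eseries : ℕ → (ℕ → ℤ) → DS ℤ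
Eseries n e j = Σℤ (divisors n) (λ d → mono (e d) d j)

E'series : ℕ → (ℕ → ℤ) → DS ℤ
E'series n e j = Σℤ (divisors n) (λ d → mono ((+ d) ℤ.* e (quot n d)) d j)

Mseries : ℕ → (ℕ → ℤ) → DS ℤ
Mseries n e j = Σℤ (divisors n) (λ d → mfun n e (+ quot n d) ℤ.* φ 0 d j)

Pseries : ℕ → (ℕ → ℤ) → DS ℤ
Pseries n e j = Σℤ (divisors n) (λ d → pfun n e (+ quot n d) ℤ.* φ 2 d j)

module _ {c ℓ : Level} (R : CommutativeRing c ℓ) where
  open CommutativeRing R

  ℕtoR : ℕ → Carrier
  ℕtoR zero    = 0#
  ℕtoR (suc k) = 1# + ℕtoR k

  ℤtoR : ℤ → Carrier
  ℤtoR (+ k)      = ℕtoR k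
  ℤtoR -[1+ k ]   = - (ℕtoR (suc k))

  ΣR : List ℕ → (ℕ → Carrier) → Carrier
  ΣR xs f = foldr (λ x acc → f x + acc) 0# xs

  _⋆_ : DS Carrier → DS Carrier → DS Carrier
  (f ⋆ g) k = ΣR (divisors k) (λ d → f d * g (quot k d))

  lift : DS ℤ → DS Carrier
  lift f k = ℤtoR (f k)

module Submission where

-- Both identities already hold coefficientwise before multiplying by G.  For d ∣ n one has
-- (n/d, n) = n/d, so m(n/d) and p(n/d) are summatory functions Σ_{c ∣ n/d} F(c), with
-- F(c) = e(n/c) resp. F(c) = c e(c).  Expanding φ_{t-s}(d) = Σ_{j ∣ d} μ(d/j) j^t j^{-s} and
-- writing d = j u, the j-th coefficient of Σ_{d ∣ n} (Σ_{c ∣ n/d} F(c)) φ_{t-s}(d) becomes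
-- j^t Σ_{u ∣ n/j} μ(u) Σ_{c ∣ n/(j u)} F(c), which is j^t F(n/j) by Möbius inversion.
-- For t = 0 this is e(j), the j-th coefficient of Σ_{d ∣ n} e(d) d^{-s}; for t = 2 it is
-- n · j e(n/j), whence the factor 1/n.  Möbius inversion rests on Σ_{u ∣ M} μ(u) = [M = 1],
-- obtained by splitting the divisors of M ≥ 2 according to a prime p ∣ M, using
-- μ(p u) = 0 for p ∣ u and μ(p u) = -μ(u) for p ∤ u.

open import Defs
open import Level using (Level)
open import Data.Bool using (Bool; true; false; if_then_else_; T)
open import Data.Bool.Properties using (T-≡; if-cong; if-cong₂; if-cong-else; if-eta; if-float)
open import Data.Bool.ListAction using (any)
open import Data.Empty using (⊥-elim)
open import Data.Fin using (toℕ)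
open import Data.Fin.Properties using (toℕ<n; toℕ-inject₁; toℕ-fromℕ)
open import Data.Integer as ℤ using (ℤ; +_; -[1+_])
import Data.Integer.Properties as ℤ
open import Data.List using ([]; _∷_; filterᵇ; applyUpTo; length)
open import Data.List.Membership.Propositional using (_∈_; find; lose)
open import Data.List.Membership.Propositional.Properties using (∈-applyUpTo⁺)
open import Data.List.Relation.Unary.All using (_∷_)
open import Data.List.Relation.Unary.Any.Properties using (any⁺; any⁻)
open import Data.Nat as ℕ using (ℕ; zero; suc; _≤_; _<_; z≤n; s≤s; _≟_; >-nonZero)
open import Data.Nat.Properties
  using (≤-refl; ≤-trans; <-irrefl; <⇒≱; m≤n⇒m<n∨m≡n; m≤n⇒m≤1+n; ≤∧≢⇒<; m≤m*n; m≤n*m)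
import Data.Nat.Properties as ℕ
open import Data.Nat.Coprimality as Coprime using (Coprime; coprime-divisor; coprime-factors)
open import Data.Nat.DivMod using (m*n/n≡m)
open import Data.Nat.Divisibility
open import Data.Nat.GCD using (gcd; gcd[m,n]∣m; gcd-greatest)
open import Data.Nat.ListAction using (product)
open import Data.Nat.Primality
  using (Prime; prime?; euclidsLemma; prime⇒irreducible; prime⇒nonZero; ¬prime[1])
open import Data.Nat.Primality.Factorisation using (factorise)
open import Data.Product using (_×_; _,_; ∃-syntax; uncurry)
open import Data.Sum using (inj₁; inj₂; reduce)
open import Function using (_∘_; _⇔_; mk⇔; Equivalence)
open import Relation.Binary.PropositionalEquality
  using (_≡_; _≢_; refl; sym; trans; cong; cong₂; subst; module ≡-Reasoning)
open import Relation.Nullary using (Dec; yes; no; does; ¬_; _×-dec_)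
open import Relation.Nullary.Decidable using (dec-true; dec-false; does-⇔)
open import Algebra.Bundles using (CommutativeRing)
open import Algebra.Properties.CommutativeMonoid.Sum ℤ.+-0-commutativeMonoid
  using (sum; ∑-comm; ∑-distrib-+; sum-cong-≗; sum-init-last; sum-replicate-zero)

sumTo : ℕ → (ℕ → ℤ) → ℤ
sumTo K f = sum {K} (λ i → f (suc (toℕ i)))

Σℤ-applyUpTo : ∀ K g f → Σℤ (applyUpTo g K) f ≡ sum {K} (λ i → f (g (toℕ i)))
Σℤ-applyUpTo zero    g f = refl
Σℤ-applyUpTo (suc K) g f = cong (ℤ._+_ (f (g 0))) (Σℤ-applyUpTo K (g ∘ suc) f)

Σℤ-posUpTo : ∀ K f → Σℤ (posUpTo K) f ≡ sumTo K f
Σℤ-posUpTo K = Σℤ-applyUpTo K suc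

sumTo-suc : ∀ K f → sumTo (suc K) f ≡ sumTo K f ℤ.+ f (suc K)
sumTo-suc K f = trans (sum-init-last {K} (λ i → f (suc (toℕ i))))
  (cong₂ ℤ._+_ (sum-cong-≗ {K} (λ i → cong (f ∘ suc) (toℕ-inject₁ i))) (cong (f ∘ suc) (toℕ-fromℕ K)))

sumTo-cong : ∀ K {f g} → (∀ x → 1 ≤ x → x ≤ K → f x ≡ g x) → sumTo K f ≡ sumTo K g
sumTo-cong K f≗g = sum-cong-≗ (λ i → f≗g _ (s≤s z≤n) (toℕ<n i))

sumTo-vanish : ∀ K {f} → (∀ x → 1 ≤ x → x ≤ K → f x ≡ + 0) → sumTo K f ≡ + 0
sumTo-vanish K f≗0 = trans (sumTo-cong K f≗0) (sum-replicate-zero K)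

sumTo-extend : ∀ {K L f} → K ≤ L → (∀ x → K < x → x ≤ L → f x ≡ + 0) → sumTo L f ≡ sumTo K f
sumTo-extend {L = zero} z≤n _ = refl
sumTo-extend {K} {suc L} {f} K≤1+L f≗0 with m≤n⇒m<n∨m≡n K≤1+L
... | inj₂ refl = refl
... | inj₁ (s≤s K≤L) = begin
  sumTo (suc L) f           ≡⟨ sumTo-suc L f ⟩
  sumTo L f ℤ.+ f (suc L)   ≡⟨ cong₂ ℤ._+_ (sumTo-extend K≤L λ x K<x x≤L → f≗0 x K<x (m≤n⇒m≤1+n x≤L))
                                            (f≗0 (suc L) (s≤s K≤L) ≤-refl) ⟩
  sumTo K f ℤ.+ + 0         ≡⟨ ℤ.+-identityʳ _ ⟩
  sumTo K f                 ∎
  where open ≡-Reasoning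

sumTo-delta : ∀ K {a f} → 1 ≤ a → a ≤ K →
              (∀ x → 1 ≤ x → x ≤ K → x ≢ a → f x ≡ + 0) → sumTo K f ≡ f a
sumTo-delta K {suc a} {f} _ a<K f≗0 = begin
  sumTo K f               ≡⟨ sumTo-extend a<K above-a ⟩
  sumTo (suc a) f         ≡⟨ sumTo-suc a f ⟩
  sumTo a f ℤ.+ f (suc a) ≡⟨ cong (ℤ._+ f (suc a)) (sumTo-vanish a below-a) ⟩
  + 0 ℤ.+ f (suc a)       ≡⟨ ℤ.+-identityˡ _ ⟩
  f (suc a)               ∎
  where
  open ≡-Reasoning
  above-a : ∀ x → suc a < x → x ≤ K → f x ≡ + 0
  above-a x a<x x≤K = f≗0 x (≤-trans (s≤s z≤n) a<x) x≤K λ { refl → <-irrefl refl a<x }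
  below-a : ∀ x → 1 ≤ x → x ≤ a → f x ≡ + 0
  below-a x 1≤x x≤a = f≗0 x 1≤x (≤-trans (m≤n⇒m≤1+n x≤a) a<K) λ { refl → <-irrefl refl (s≤s x≤a) }

sumTo-comm : ∀ K L (F : ℕ → ℕ → ℤ) →
             sumTo K (λ x → sumTo L (F x)) ≡ sumTo L (λ y → sumTo K (λ x → F x y))
sumTo-comm K L F = ∑-comm {K} {L} (λ i i′ → F (suc (toℕ i)) (suc (toℕ i′)))

indicator : Bool → ℤ
indicator b = if b then + 1 else + 0

length-filterᵇ : ∀ P xs → + length (filterᵇ P xs) ≡ Σℤ xs (indicator ∘ P)
length-filterᵇ P []       = refl
length-filterᵇ P (x ∷ xs) with P x
... | true  = cong (ℤ._+_ (+ 1)) (length-filterᵇ P xs)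
... | false = trans (length-filterᵇ P xs) (sym (ℤ.+-identityˡ _))

Σℤ-filterᵇ : ∀ P xs f → Σℤ (filterᵇ P xs) f ≡ Σℤ xs (λ x → if P x then f x else + 0)
Σℤ-filterᵇ P []       f = refl
Σℤ-filterᵇ P (x ∷ xs) f with P x
... | true  = cong (ℤ._+_ (f x)) (Σℤ-filterᵇ P xs f)
... | false = trans (Σℤ-filterᵇ P xs f) (sym (ℤ.+-identityˡ _))

Σℤ-filter-cong : ∀ {P : ℕ → Set} (P? : ∀ x → Dec (P x)) xs {f g} → (∀ x → P x → f x ≡ g x) →
                 Σℤ (filterᵇ (does ∘ P?) xs) f ≡ Σℤ (filterᵇ (does ∘ P?) xs) g
Σℤ-filter-cong P? []       f≗g = refl
Σℤ-filter-cong P? (x ∷ xs) f≗g with P? x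
... | yes Px = cong₂ ℤ._+_ (f≗g x Px) (Σℤ-filter-cong P? xs f≗g)
... | no  _  = Σℤ-filter-cong P? xs f≗g

Σℤ-zero : ∀ xs → Σℤ xs (λ _ → + 0) ≡ + 0
Σℤ-zero []       = refl
Σℤ-zero (x ∷ xs) = trans (ℤ.+-identityˡ _) (Σℤ-zero xs)

Σℤ-+ : ∀ xs f g → Σℤ xs (λ x → f x ℤ.+ g x) ≡ Σℤ xs f ℤ.+ Σℤ xs g
Σℤ-+ []       f g = refl
Σℤ-+ (x ∷ xs) f g = trans (cong (ℤ._+_ (f x ℤ.+ g x)) (Σℤ-+ xs f g)) (interchange (f x) (g x) _ _)
  where open import Algebra.Properties.CommutativeSemigroup ℤ.+-commutativeSemigroup using (interchange)

Σℤ-neg : ∀ xs f → Σℤ xs (λ x → ℤ.- f x) ≡ ℤ.- Σℤ xs f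
Σℤ-neg []       f = refl
Σℤ-neg (x ∷ xs) f = trans (cong (ℤ._+_ (ℤ.- f x)) (Σℤ-neg xs f)) (sym (ℤ.neg-distrib-+ (f x) _))

Σℤ-*ˡ : ∀ xs c f → Σℤ xs (λ x → c ℤ.* f x) ≡ c ℤ.* Σℤ xs f
Σℤ-*ˡ []       c f = sym (ℤ.*-zeroʳ c)
Σℤ-*ˡ (x ∷ xs) c f = trans (cong (ℤ._+_ (c ℤ.* f x)) (Σℤ-*ˡ xs c f)) (sym (ℤ.*-distribˡ-+ c (f x) _))

Σℤ-*ʳ : ∀ xs c f → Σℤ xs (λ x → f x ℤ.* c) ≡ Σℤ xs f ℤ.* c
Σℤ-*ʳ []       c f = refl
Σℤ-*ʳ (x ∷ xs) c f = trans (cong (ℤ._+_ (f x ℤ.* c)) (Σℤ-*ʳ xs c f)) (sym (ℤ.*-distribʳ-+ c (f x) _))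

divisor-pos : ∀ {d n} → 1 ≤ n → d ∣ n → 1 ≤ d
divisor-pos {zero}  1≤n 0∣n = ⊥-elim (<-irrefl (sym (0∣⇒≡0 0∣n)) 1≤n)
divisor-pos {suc d} _   _   = s≤s z≤n

divisor-≤ : ∀ {d n} → 1 ≤ n → d ∣ n → d ≤ n
divisor-≤ 1≤n = ∣⇒≤ ⦃ >-nonZero 1≤n ⦄

quot-* : ∀ m {n} → 1 ≤ n → quot (m ℕ.* n) n ≡ m
quot-* m {suc n} _ = m*n/n≡m m (suc n)

quot-∣ : ∀ {d n} → 1 ≤ n → d ∣ n → quot n d ∣ n
quot-∣ 1≤n d∣n@(divides q refl) rewrite quot-* q (divisor-pos 1≤n d∣n) = m∣m*n _

quot-pos : ∀ {d n} → 1 ≤ n → d ∣ n → 1 ≤ quot n d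
quot-pos 1≤n d∣n = divisor-pos 1≤n (quot-∣ 1≤n d∣n)

quot-≤ : ∀ {d n} → 1 ≤ n → d ∣ n → quot n d ≤ n
quot-≤ 1≤n d∣n = divisor-≤ 1≤n (quot-∣ 1≤n d∣n)

quot-quot : ∀ {d n} → 1 ≤ n → d ∣ n → quot n (quot n d) ≡ d
quot-quot {d} 1≤n d∣n@(divides q refl) = begin
  quot (q ℕ.* d) (quot (q ℕ.* d) d) ≡⟨ cong (quot (q ℕ.* d)) q≡ ⟩
  quot (q ℕ.* d) q                  ≡⟨ cong (λ m → quot m q) (ℕ.*-comm q d) ⟩
  quot (d ℕ.* q) q                  ≡⟨ quot-* d (subst (1 ≤_) q≡ (quot-pos 1≤n d∣n)) ⟩
  d                                 ∎
  where
  open ≡-Reasoning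
  q≡ : quot (q ℕ.* d) d ≡ q
  q≡ = quot-* q (divisor-pos 1≤n d∣n)

quot-*-quot : ∀ {n j u} → 1 ≤ n → j ∣ n → u ∣ quot n j → quot n (j ℕ.* u) ≡ quot (quot n j) u
quot-*-quot {j = j} {u} 1≤n j∣n@(divides N refl) u∣N rewrite quot-* N (divisor-pos 1≤n j∣n)
  with u∣N
... | divides v refl = begin
  quot (v ℕ.* u ℕ.* j) (j ℕ.* u)   ≡⟨ cong (λ m → quot m (j ℕ.* u)) vuj≡v[ju] ⟩
  quot (v ℕ.* (j ℕ.* u)) (j ℕ.* u) ≡⟨ quot-* v (ℕ.*-mono-≤ 1≤j 1≤u) ⟩
  v                                ≡⟨ quot-* v 1≤u ⟨
  quot (v ℕ.* u) u                 ∎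
  where
  open ≡-Reasoning
  vuj≡v[ju] : v ℕ.* u ℕ.* j ≡ v ℕ.* (j ℕ.* u)
  vuj≡v[ju] = trans (ℕ.*-assoc v u j) (cong (v ℕ.*_) (ℕ.*-comm u j))
  1≤j : 1 ≤ j
  1≤j = divisor-pos 1≤n j∣n
  1≤u : 1 ≤ u
  1≤u = divisor-pos (divisor-pos 1≤n (m∣m*n j)) (n∣m*n v)

quot≡1⇔≡ : ∀ {c N} → 1 ≤ N → c ∣ N → quot N c ≡ 1 ⇔ c ≡ N
quot≡1⇔≡ {c} 1≤N c∣N@(divides q refl) = mk⇔
  (λ q≡1 → trans (sym (ℕ.*-identityˡ c)) (cong (ℕ._* c) (trans (sym q≡1) (quot-* q 1≤c))))
  (λ c≡N → trans (cong (λ m → quot m c) (sym c≡N))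
                 (trans (cong (λ m → quot m c) (sym (ℕ.*-identityˡ c))) (quot-* 1 1≤c)))
  where 1≤c = divisor-pos 1≤N c∣N

∣-quot-swap : ∀ {u c N} → 1 ≤ u → 1 ≤ c → u ∣ N → c ∣ quot N u → c ∣ N × u ∣ quot N c
∣-quot-swap {u} {c} 1≤u 1≤c (divides a refl) c∣a rewrite quot-* a 1≤u with c∣a
... | divides b refl = divides (b ℕ.* u) bcu≡buc , subst (u ∣_) (sym quot≡bu) (n∣m*n b)
  where
  bcu≡buc : b ℕ.* c ℕ.* u ≡ b ℕ.* u ℕ.* c
  bcu≡buc = trans (ℕ.*-assoc b c u) (trans (cong (b ℕ.*_) (ℕ.*-comm c u)) (sym (ℕ.*-assoc b u c)))
  quot≡bu : quot (b ℕ.* c ℕ.* u) c ≡ b ℕ.* u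
  quot≡bu = trans (cong (λ m → quot m c) bcu≡buc) (quot-* (b ℕ.* u) 1≤c)

divisor-pair-swap : ∀ {u c N} → 1 ≤ u → 1 ≤ c →
                    (u ∣ N × c ∣ quot N u) ⇔ (c ∣ N × u ∣ quot N c)
divisor-pair-swap 1≤u 1≤c = mk⇔ (uncurry (∣-quot-swap 1≤u 1≤c)) (uncurry (∣-quot-swap 1≤c 1≤u))

m∣n⇒gcd[m,n]≡m : ∀ {m n} → m ∣ n → gcd m n ≡ m
m∣n⇒gcd[m,n]≡m {m} {n} m∣n = ∣-antisym (gcd[m,n]∣m m n) (gcd-greatest ∣-refl m∣n)

prime-pos : ∀ {p} → Prime p → 1 ≤ p
prime-pos pp = ℕ.>-nonZero⁻¹ _ ⦃ prime⇒nonZero pp ⦄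

primes-∣⇒≡ : ∀ {x p} → Prime x → Prime p → x ∣ p → x ≡ p
primes-∣⇒≡ px pp x∣p with prime⇒irreducible pp x∣p
... | inj₁ refl = ⊥-elim (¬prime[1] px)
... | inj₂ x≡p  = x≡p

prime∤⇒coprime : ∀ {p m} → Prime p → ¬ p ∣ m → Coprime p m
prime∤⇒coprime pp p∤m (d∣p , d∣m) with prime⇒irreducible pp d∣p
... | inj₁ d≡1  = d≡1
... | inj₂ refl = ⊥-elim (p∤m d∣m)

prime-factor : ∀ {M} → 2 ≤ M → ∃[ p ] Prime p × p ∣ M
prime-factor {M@(suc _)} 2≤M with factorise M
... | record { factors = [] ; isFactorisation = M≡1 } = ⊥-elim (<-irrefl (sym M≡1) 2≤M)
... | record { factors = p ∷ ps ; isFactorisation = M≡ ; factorsPrime = pp ∷ _ } =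
  p , pp , divides (product ps) (trans M≡ (ℕ.*-comm p _))

-- Sums over divisors

Σℤ-divisors-cong : ∀ n {f g} → (∀ d → d ∣ n → f d ≡ g d) → Σℤ (divisors n) f ≡ Σℤ (divisors n) g
Σℤ-divisors-cong n = Σℤ-filter-cong (_∣? n) (posUpTo n)

Σℤ-divisors-vanish : ∀ n {f} → (∀ d → d ∣ n → f d ≡ + 0) → Σℤ (divisors n) f ≡ + 0
Σℤ-divisors-vanish n f≗0 = trans (Σℤ-divisors-cong n f≗0) (Σℤ-zero (divisors n))

Σℤ-divisors : ∀ {n K} f → 1 ≤ n → n ≤ K →
              Σℤ (divisors n) f ≡ sumTo K (λ x → if does (x ∣? n) then f x else + 0)
Σℤ-divisors {n} {K} f 1≤n n≤K = begin
  Σℤ (divisors n) f ≡⟨ Σℤ-filterᵇ _ (posUpTo n) f ⟩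
  Σℤ (posUpTo n) f∣ ≡⟨ Σℤ-posUpTo n f∣ ⟩
  sumTo n f∣        ≡⟨ sumTo-extend n≤K above-n ⟨
  sumTo K f∣        ∎
  where
  open ≡-Reasoning
  f∣ : ℕ → ℤ
  f∣ x = if does (x ∣? n) then f x else + 0
  above-n : ∀ x → n < x → x ≤ K → f∣ x ≡ + 0
  above-n x n<x _ = if-cong (dec-false (x ∣? n) λ x∣n → <⇒≱ n<x (divisor-≤ 1≤n x∣n))

mono-≡ : ∀ c j → mono c j j ≡ c
mono-≡ c j rewrite dec-true (j ≟ j) refl = refl

mono-≢ : ∀ c x j → x ≢ j → mono c x j ≡ + 0
mono-≢ c x j x≢j rewrite dec-false (x ≟ j) x≢j = refl

Σℤ-divisors-mono : ∀ {n} j (h : ℕ → ℤ) → 1 ≤ n →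
                   Σℤ (divisors n) (λ x → mono (h x) x j) ≡ (if does (j ∣? n) then h j else + 0)
Σℤ-divisors-mono {n} j h 1≤n = trans (Σℤ-divisors (λ x → mono (h x) x j) 1≤n ≤-refl) (by-cases (j ∣? n))
  where
  term : ℕ → ℤ
  term x = if does (x ∣? n) then mono (h x) x j else + 0
  off-j : ∀ x → x ≢ j → term x ≡ + 0
  off-j x x≢j with x ∣? n
  ... | yes _ = mono-≢ (h x) x j x≢j
  ... | no  _ = refl
  by-cases : (j∣?n : Dec (j ∣ n)) → sumTo n term ≡ (if does j∣?n then h j else + 0)
  by-cases (yes j∣n) = begin
    sumTo n term   ≡⟨ sumTo-delta n (divisor-pos 1≤n j∣n) (divisor-≤ 1≤n j∣n) (λ x _ _ → off-j x) ⟩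
    term j         ≡⟨ if-cong (dec-true (j ∣? n) j∣n) ⟩
    mono (h j) j j ≡⟨ mono-≡ (h j) j ⟩
    h j            ∎
    where open ≡-Reasoning
  by-cases (no j∤n) = sumTo-vanish n λ x _ _ → no-term x
    where
    no-term : ∀ x → term x ≡ + 0
    no-term x with x ∣? n
    ... | yes x∣n = mono-≢ (h x) x j λ { refl → j∤n x∣n }
    ... | no  _   = refl

Σℤ-divisors-multiples : ∀ {n j} (g : ℕ → ℤ) → 1 ≤ n → j ∣ n →
  Σℤ (divisors n) (λ d → if does (j ∣? d) then g d else + 0)
  ≡ Σℤ (divisors (quot n j)) (λ u → g (j ℕ.* u))
Σℤ-divisors-multiples {n} {j} g 1≤n j∣n@(divides N refl) = begin
  Σℤ (divisors n) (λ d → if does (j ∣? d) then g d else + 0)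
    ≡⟨ Σℤ-divisors (λ d → if does (j ∣? d) then g d else + 0) 1≤n ≤-refl ⟩
  sumTo n (λ d → if does (d ∣? n) then (if does (j ∣? d) then g d else + 0) else + 0)
    ≡⟨ sumTo-cong n (λ d _ _ → row d (d ∣? n) (j ∣? d)) ⟩
  sumTo n (λ d → sumTo n (λ u → E d u))
    ≡⟨ sumTo-comm n n E ⟩
  sumTo n (λ u → sumTo n (λ d → E d u))
    ≡⟨ sumTo-cong n (λ u _ _ → column u (u ∣? N)) ⟩
  sumTo n (λ u → if does (u ∣? N) then g (j ℕ.* u) else + 0)
    ≡⟨ Σℤ-divisors (λ u → g (j ℕ.* u)) 1≤N N≤n ⟨
  Σℤ (divisors N) (λ u → g (j ℕ.* u))
    ≡⟨ cong (λ m → Σℤ (divisors m) (λ u → g (j ℕ.* u))) (quot-* N 1≤j) ⟨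
  Σℤ (divisors (quot n j)) (λ u → g (j ℕ.* u)) ∎
  where
  open ≡-Reasoning
  instance _ = >-nonZero (divisor-pos 1≤n j∣n)
  1≤j : 1 ≤ j
  1≤j = divisor-pos 1≤n j∣n
  1≤N : 1 ≤ N
  1≤N = divisor-pos 1≤n (m∣m*n j)
  N≤n : N ≤ n
  N≤n = m≤m*n N j
  ju∣n : ∀ {u} → u ∣ N → j ℕ.* u ∣ n
  ju∣n {u} u∣N = subst (j ℕ.* u ∣_) (ℕ.*-comm j N) (*-monoʳ-∣ j u∣N)
  -- Both sides are the sum of E over the pairs (j u, u) with u ∣ N.
  E : ℕ → ℕ → ℤ
  E d u = if does ((u ∣? N) ×-dec (d ≟ j ℕ.* u)) then g d else + 0
  E-hit : ∀ {d u} → u ∣ N → d ≡ j ℕ.* u → E d u ≡ g d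
  E-hit {d} {u} u∣N d≡ju = if-cong (dec-true ((u ∣? N) ×-dec (d ≟ j ℕ.* u)) (u∣N , d≡ju))
  E-miss : ∀ d u → ¬ (u ∣ N × d ≡ j ℕ.* u) → E d u ≡ + 0
  E-miss d u miss = if-cong (dec-false ((u ∣? N) ×-dec (d ≟ j ℕ.* u)) miss)
  row : ∀ d (d∣?n : Dec (d ∣ n)) (j∣?d : Dec (j ∣ d)) →
        (if does d∣?n then (if does j∣?d then g d else + 0) else + 0) ≡ sumTo n (λ u → E d u)
  row d (yes d∣n) (yes (divides q refl)) =
    sym (trans (sumTo-delta n (divisor-pos 1≤N q∣N) (≤-trans (divisor-≤ 1≤N q∣N) N≤n) off-q)
               (E-hit q∣N (ℕ.*-comm q j)))
    where
    q∣N = *-cancelʳ-∣ j d∣n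
    off-q : ∀ u → 1 ≤ u → u ≤ n → u ≢ q → E d u ≡ + 0
    off-q u _ _ u≢q = E-miss d u λ (_ , qj≡ju) → u≢q (ℕ.*-cancelʳ-≡ u q j (trans (ℕ.*-comm u j) (sym qj≡ju)))
  row d (yes _)   (no j∤d) = sym (sumTo-vanish n λ u _ _ →
    E-miss d u λ (_ , d≡ju) → j∤d (divides u (trans d≡ju (ℕ.*-comm j u))))
  row d (no d∤n)  _        = sym (sumTo-vanish n λ u _ _ →
    E-miss d u λ (u∣N , d≡ju) → d∤n (subst (_∣ n) (sym d≡ju) (ju∣n u∣N)))
  column : ∀ u (u∣?N : Dec (u ∣ N)) → sumTo n (λ d → E d u) ≡ (if does u∣?N then g (j ℕ.* u) else + 0)
  column u (yes u∣N) =
    trans (sumTo-delta n (divisor-pos 1≤n (ju∣n u∣N)) (divisor-≤ 1≤n (ju∣n u∣N))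
                       (λ d _ _ d≢ju → E-miss d u λ (_ , d≡ju) → d≢ju d≡ju))
          (E-hit u∣N refl)
  column u (no u∤N) = sumTo-vanish n λ d _ _ → E-miss d u λ (u∣N , _) → u∤N u∣N

divisor-pair? : ∀ N u c → Dec (u ∣ N × c ∣ quot N u)
divisor-pair? N u c = (u ∣? N) ×-dec (c ∣? quot N u)

Σℤ-divisor-pairs : ∀ {N} (H : ℕ → ℕ → ℤ) → 1 ≤ N →
  Σℤ (divisors N) (λ u → Σℤ (divisors (quot N u)) (H u))
  ≡ sumTo N (λ u → sumTo N (λ c → if does (divisor-pair? N u c) then H u c else + 0))
Σℤ-divisor-pairs {N} H 1≤N = trans (Σℤ-divisors (λ u → Σℤ (divisors (quot N u)) (H u)) 1≤N ≤-refl)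
                                   (sumTo-cong N λ u _ _ → inner u (u ∣? N))
  where
  inner : ∀ u (u∣?N : Dec (u ∣ N)) →
          (if does u∣?N then Σℤ (divisors (quot N u)) (H u) else + 0)
          ≡ sumTo N (λ c → if does (u∣?N ×-dec (c ∣? quot N u)) then H u c else + 0)
  inner u (yes u∣N) = Σℤ-divisors (H u) (quot-pos 1≤N u∣N) (quot-≤ 1≤N u∣N)
  inner u (no _)    = sym (sumTo-vanish N λ _ _ _ → refl)

Σℤ-divisors-swap : ∀ {N} (H : ℕ → ℕ → ℤ) → 1 ≤ N →
  Σℤ (divisors N) (λ u → Σℤ (divisors (quot N u)) (H u))
  ≡ Σℤ (divisors N) (λ c → Σℤ (divisors (quot N c)) (λ u → H u c))
Σℤ-divisors-swap {N} H 1≤N = begin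
  Σℤ (divisors N) (λ u → Σℤ (divisors (quot N u)) (H u))         ≡⟨ Σℤ-divisor-pairs H 1≤N ⟩
  sumTo N (λ u → sumTo N (λ c → pair u c))                        ≡⟨ sumTo-comm N N pair ⟩
  sumTo N (λ c → sumTo N (λ u → pair u c))                        ≡⟨ sumTo-cong N (λ c 1≤c _ →
                                                                       sumTo-cong N (λ u 1≤u _ → swap 1≤u 1≤c)) ⟩
  sumTo N (λ c → sumTo N (λ u → pair′ c u))                       ≡⟨ Σℤ-divisor-pairs (λ c u → H u c) 1≤N ⟨
  Σℤ (divisors N) (λ c → Σℤ (divisors (quot N c)) (λ u → H u c)) ∎
  where
  open ≡-Reasoning
  pair pair′ : ℕ → ℕ → ℤ
  pair  u c = if does (divisor-pair? N u c) then H u c else + 0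
  pair′ c u = if does (divisor-pair? N c u) then H u c else + 0
  swap : ∀ {u c} → 1 ≤ u → 1 ≤ c → pair u c ≡ pair′ c u
  swap {u} {c} 1≤u 1≤c =
    if-cong (does-⇔ (divisor-pair-swap 1≤u 1≤c) (divisor-pair? N u c) (divisor-pair? N c u))

Σℤ-divisors-prime*-∤ : ∀ {p m} (f : ℕ → ℤ) → Prime p → 1 ≤ m →
  Σℤ (divisors (p ℕ.* m)) (λ u → if does (p ∣? u) then + 0 else f u)
  ≡ Σℤ (divisors m) (λ u → if does (p ∣? u) then + 0 else f u)
Σℤ-divisors-prime*-∤ {p} {m} f pp 1≤m = begin
  Σℤ (divisors (p ℕ.* m)) f′                                        ≡⟨ Σℤ-divisors f′ 1≤pm ≤-refl ⟩
  sumTo (p ℕ.* m) (λ u → if does (u ∣? p ℕ.* m) then f′ u else + 0) ≡⟨ sumTo-cong (p ℕ.* m) (λ u _ _ → same u) ⟩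
  sumTo (p ℕ.* m) (λ u → if does (u ∣? m) then f′ u else + 0)       ≡⟨ Σℤ-divisors f′ 1≤m m≤pm ⟨
  Σℤ (divisors m) f′                                                ∎
  where
  open ≡-Reasoning
  f′ : ℕ → ℤ
  f′ u = if does (p ∣? u) then + 0 else f u
  m≤pm : m ≤ p ℕ.* m
  m≤pm = m≤n*m m p ⦃ prime⇒nonZero pp ⦄
  1≤pm : 1 ≤ p ℕ.* m
  1≤pm = ≤-trans 1≤m m≤pm
  same : ∀ u → (if does (u ∣? p ℕ.* m) then f′ u else + 0) ≡ (if does (u ∣? m) then f′ u else + 0)
  same u with p ∣? u
  ... | yes _   = trans (if-eta (does (u ∣? p ℕ.* m))) (sym (if-eta (does (u ∣? m))))
  ... | no  p∤u = if-cong (does-⇔ (mk⇔ (coprime-divisor (Coprime.sym (prime∤⇒coprime pp p∤u))) (∣n⇒∣m*n p))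
                                   (u ∣? p ℕ.* m) (u ∣? m))

-- The Möbius function

T-does⁺ : ∀ {P : Set} (P? : Dec P) → P → T (does P?)
T-does⁺ P? p = Equivalence.from T-≡ (dec-true P? p)

T-does⁻ : ∀ {P : Set} (P? : Dec P) → T (does P?) → P
T-does⁻ (yes p) _ = p

T-injective : ∀ {a b} → (T a → T b) → (T b → T a) → a ≡ b
T-injective {false} {false} _   _   = refl
T-injective {false} {true}  _   b⇒a = ⊥-elim (b⇒a _)
T-injective {true}  {false} a⇒b _   = ⊥-elim (a⇒b _)
T-injective {true}  {true}  _   _   = refl

∈-posUpTo : ∀ {x k} → 1 ≤ x → x ≤ k → x ∈ posUpTo k
∈-posUpTo (s≤s z≤n) x≤k = ∈-applyUpTo⁺ suc x≤k

squareful : ℕ → Bool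
squareful k = any (λ x → does (prime? x ×-dec (x ℕ.* x) ∣? k)) (posUpTo k)

ω : ℕ → ℕ
ω k = length (filterᵇ (λ x → does (prime? x ×-dec x ∣? k)) (posUpTo k))

μ-unfold : ∀ {k} → 1 ≤ k → μ k ≡ (if squareful k then + 0 else -[1+ 0 ] ℤ.^ ω k)
μ-unfold (s≤s z≤n) = refl

squareful⁺ : ∀ {x k} → 1 ≤ k → Prime x → x ℕ.* x ∣ k → T (squareful k)
squareful⁺ {x} {k} 1≤k px xx∣k =
  any⁺ _ (lose (∈-posUpTo (prime-pos px) (divisor-≤ 1≤k (∣-trans (m∣m*n x) xx∣k)))
               (T-does⁺ (prime? x ×-dec (x ℕ.* x) ∣? k) (px , xx∣k)))

squareful⁻ : ∀ {k} → T (squareful k) → ∃[ x ] Prime x × x ℕ.* x ∣ k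
squareful⁻ {k} sq with x , _ , Tx ← find (any⁻ _ (posUpTo k) sq) =
  x , T-does⁻ (prime? x ×-dec (x ℕ.* x) ∣? k) Tx

squareful-prime* : ∀ {p u} → Prime p → ¬ p ∣ u → 1 ≤ u → squareful (p ℕ.* u) ≡ squareful u
squareful-prime* {p} {u} pp p∤u 1≤u = T-injective to from
  where
  instance _ = prime⇒nonZero pp
  xx∣u : ∀ {x} → Prime x → x ℕ.* x ∣ p ℕ.* u → x ℕ.* x ∣ u
  xx∣u {x} px xx∣pu with x ≟ p
  ... | yes refl = ⊥-elim (p∤u (*-cancelˡ-∣ p xx∣pu))
  ... | no  x≢p  = coprime-factors (prime∤⇒coprime pp p∤xx) (xx∣pu , m∣m*n u)
    where
    p∤xx : ¬ p ∣ x ℕ.* x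
    p∤xx p∣xx = x≢p (sym (primes-∣⇒≡ pp px (reduce (euclidsLemma x x pp p∣xx))))
  to : T (squareful (p ℕ.* u)) → T (squareful u)
  to sq with x , px , xx∣pu ← squareful⁻ sq = squareful⁺ 1≤u px (xx∣u px xx∣pu)
  from : T (squareful u) → T (squareful (p ℕ.* u))
  from sq with x , px , xx∣u ← squareful⁻ sq = squareful⁺ (≤-trans 1≤u (m≤n*m u p)) px (∣n⇒∣m*n p xx∣u)

prime-divisor : ℕ → ℕ → ℤ
prime-divisor k x = indicator (does (prime? x ×-dec x ∣? k))

ω≡Σprime-divisor : ∀ k → + ω k ≡ sumTo k (prime-divisor k)
ω≡Σprime-divisor k = trans (length-filterᵇ _ (posUpTo k)) (Σℤ-posUpTo k (prime-divisor k))

prime-divisor-prime* : ∀ {p u} → Prime p → ¬ p ∣ u → ∀ x →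
                       prime-divisor (p ℕ.* u) x ≡ indicator (does (x ≟ p)) ℤ.+ prime-divisor u x
prime-divisor-prime* {p} {u} pp p∤u x with x ≟ p
... | yes refl rewrite dec-true  (prime? p ×-dec p ∣? p ℕ.* u) (pp , m∣m*n u)
                     | dec-false (prime? p ×-dec p ∣? u) (λ (_ , p∣u) → p∤u p∣u)
                     | dec-true  (p ≟ p) refl = refl
... | no  x≢p  = begin
  prime-divisor (p ℕ.* u) x
    ≡⟨ cong indicator (does-⇔ same-condition (prime? x ×-dec x ∣? p ℕ.* u) (prime? x ×-dec x ∣? u)) ⟩
  prime-divisor u x
    ≡⟨ ℤ.+-identityˡ _ ⟨
  + 0 ℤ.+ prime-divisor u x
    ≡⟨ cong (ℤ._+ prime-divisor u x) (if-cong (dec-false (x ≟ p) x≢p)) ⟨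
  indicator (does (x ≟ p)) ℤ.+ prime-divisor u x ∎
  where
  open ≡-Reasoning
  x∣u : Prime x → x ∣ p ℕ.* u → x ∣ u
  x∣u px x∣pu with euclidsLemma p u px x∣pu
  ... | inj₁ x∣p = ⊥-elim (x≢p (primes-∣⇒≡ px pp x∣p))
  ... | inj₂ x∣u = x∣u
  same-condition : (Prime x × x ∣ p ℕ.* u) ⇔ (Prime x × x ∣ u)
  same-condition = mk⇔ (λ (px , x∣pu) → px , x∣u px x∣pu) (λ (px , x∣u) → px , ∣n⇒∣m*n p x∣u)

ω-prime* : ∀ {p u} → Prime p → ¬ p ∣ u → 1 ≤ u → ω (p ℕ.* u) ≡ suc (ω u)
ω-prime* {p} {u} pp p∤u 1≤u = ℤ.+-injective (begin
  + ω (p ℕ.* u)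
    ≡⟨ ω≡Σprime-divisor (p ℕ.* u) ⟩
  sumTo (p ℕ.* u) (prime-divisor (p ℕ.* u))
    ≡⟨ sumTo-cong (p ℕ.* u) (λ x _ _ → prime-divisor-prime* pp p∤u x) ⟩
  sumTo (p ℕ.* u) (λ x → is-p x ℤ.+ prime-divisor u x)
    ≡⟨ ∑-distrib-+ {p ℕ.* u} _ _ ⟩
  sumTo (p ℕ.* u) is-p ℤ.+ sumTo (p ℕ.* u) (prime-divisor u)
    ≡⟨ cong₂ ℤ._+_ (sumTo-delta (p ℕ.* u) (prime-pos pp) (m≤m*n p u) off-p)
                   (sumTo-extend (m≤n*m u p) above-u) ⟩
  is-p p ℤ.+ sumTo u (prime-divisor u)
    ≡⟨ cong₂ ℤ._+_ (if-cong (dec-true (p ≟ p) refl)) (sym (ω≡Σprime-divisor u)) ⟩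
  + 1 ℤ.+ + ω u ∎)
  where
  open ≡-Reasoning
  instance _ = prime⇒nonZero pp
  instance _ = >-nonZero 1≤u
  is-p : ℕ → ℤ
  is-p x = indicator (does (x ≟ p))
  off-p : ∀ x → 1 ≤ x → x ≤ p ℕ.* u → x ≢ p → is-p x ≡ + 0
  off-p x _ _ x≢p = if-cong (dec-false (x ≟ p) x≢p)
  above-u : ∀ x → u < x → x ≤ p ℕ.* u → prime-divisor u x ≡ + 0
  above-u x u<x _ = if-cong (dec-false (prime? x ×-dec x ∣? u) λ (_ , x∣u) → <⇒≱ u<x (divisor-≤ 1≤u x∣u))

μ[p*u]≡0 : ∀ {p u} → Prime p → p ∣ u → 1 ≤ u → μ (p ℕ.* u) ≡ + 0
μ[p*u]≡0 {p} {u} pp p∣u 1≤u =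
  trans (μ-unfold 1≤pu) (if-cong (Equivalence.to T-≡ (squareful⁺ 1≤pu pp (*-monoʳ-∣ p p∣u))))
  where
  1≤pu : 1 ≤ p ℕ.* u
  1≤pu = ≤-trans 1≤u (m≤n*m u p ⦃ prime⇒nonZero pp ⦄)

μ[p*u]≡-μ[u] : ∀ {p u} → Prime p → ¬ p ∣ u → 1 ≤ u → μ (p ℕ.* u) ≡ ℤ.- μ u
μ[p*u]≡-μ[u] {p} {u} pp p∤u 1≤u
  rewrite μ-unfold (≤-trans 1≤u (m≤n*m u p ⦃ prime⇒nonZero pp ⦄)) | μ-unfold 1≤u
        | squareful-prime* pp p∤u 1≤u | ω-prime* pp p∤u 1≤u
  with squareful u
... | true  = refl
... | false = ℤ.-1*i≡-i _

Σℤ-divisors-μ-nontrivial : ∀ {M} → 2 ≤ M → Σℤ (divisors M) μ ≡ + 0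
Σℤ-divisors-μ-nontrivial {M} 2≤M with p , pp , divides M′ refl ← prime-factor 2≤M = begin
  Σℤ (divisors M) μ                                      ≡⟨ Σℤ-divisors-cong M (λ u _ → split u) ⟩
  Σℤ (divisors M) (λ u → with-p u ℤ.+ without-p u)       ≡⟨ Σℤ-+ (divisors M) with-p without-p ⟩
  Σℤ (divisors M) with-p ℤ.+ Σℤ (divisors M) without-p   ≡⟨ cong₂ ℤ._+_ with-p-sum without-p-sum ⟩
  ℤ.- S ℤ.+ S                                            ≡⟨ ℤ.+-inverseˡ S ⟩
  + 0                                                    ∎
  where
  open ≡-Reasoning
  1≤M : 1 ≤ M
  1≤M = ≤-trans (s≤s z≤n) 2≤M
  1≤M′ : 1 ≤ M′
  1≤M′ = divisor-pos 1≤M (m∣m*n p)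
  with-p without-p : ℕ → ℤ
  with-p    u = if does (p ∣? u) then μ u else + 0
  without-p u = if does (p ∣? u) then + 0 else μ u
  S : ℤ
  S = Σℤ (divisors M′) without-p
  split : ∀ u → μ u ≡ with-p u ℤ.+ without-p u
  split u with p ∣? u
  ... | yes _ = sym (ℤ.+-identityʳ _)
  ... | no  _ = sym (ℤ.+-identityˡ _)
  μ[p*w] : ∀ w → w ∣ M′ → μ (p ℕ.* w) ≡ ℤ.- without-p w
  μ[p*w] w w∣M′ with p ∣? w
  ... | yes p∣w = μ[p*u]≡0 pp p∣w (divisor-pos 1≤M′ w∣M′)
  ... | no  p∤w = μ[p*u]≡-μ[u] pp p∤w (divisor-pos 1≤M′ w∣M′)
  with-p-sum : Σℤ (divisors M) with-p ≡ ℤ.- S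
  with-p-sum = begin
    Σℤ (divisors M) with-p                       ≡⟨ Σℤ-divisors-multiples μ 1≤M (n∣m*n M′) ⟩
    Σℤ (divisors (quot M p)) (λ w → μ (p ℕ.* w)) ≡⟨ cong (λ m → Σℤ (divisors m) (λ w → μ (p ℕ.* w)))
                                                          (quot-* M′ (prime-pos pp)) ⟩
    Σℤ (divisors M′) (λ w → μ (p ℕ.* w))         ≡⟨ Σℤ-divisors-cong M′ μ[p*w] ⟩
    Σℤ (divisors M′) (λ w → ℤ.- without-p w)     ≡⟨ Σℤ-neg (divisors M′) without-p ⟩
    ℤ.- S                                        ∎
  without-p-sum : Σℤ (divisors M) without-p ≡ S
  without-p-sum = trans (cong (λ m → Σℤ (divisors m) without-p) (ℕ.*-comm M′ p))
                        (Σℤ-divisors-prime*-∤ μ pp 1≤M′)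

Σℤ-divisors-μ : ∀ {M} → 1 ≤ M → Σℤ (divisors M) μ ≡ (if does (M ≟ 1) then + 1 else + 0)
Σℤ-divisors-μ {M} 1≤M with M ≟ 1
... | yes refl = refl
... | no  M≢1  = trans (Σℤ-divisors-μ-nontrivial (≤∧≢⇒< 1≤M (M≢1 ∘ sym)))
                       (sym (if-cong (dec-false (M ≟ 1) M≢1)))

möbius-inversion : ∀ {N} (F : ℕ → ℤ) → 1 ≤ N →
                   Σℤ (divisors N) (λ u → μ u ℤ.* Σℤ (divisors (quot N u)) F) ≡ F N
möbius-inversion {N} F 1≤N = begin
  Σℤ (divisors N) (λ u → μ u ℤ.* Σℤ (divisors (quot N u)) F)
    ≡⟨ Σℤ-divisors-cong N (λ u _ → sym (Σℤ-*ˡ (divisors (quot N u)) (μ u) F)) ⟩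
  Σℤ (divisors N) (λ u → Σℤ (divisors (quot N u)) (λ c → μ u ℤ.* F c))
    ≡⟨ Σℤ-divisors-swap (λ u c → μ u ℤ.* F c) 1≤N ⟩
  Σℤ (divisors N) (λ c → Σℤ (divisors (quot N c)) (λ u → μ u ℤ.* F c))
    ≡⟨ Σℤ-divisors-cong N (λ c c∣N → trans (Σℤ-*ʳ (divisors (quot N c)) (F c) μ) (collapse c∣N)) ⟩
  Σℤ (divisors N) (λ c → mono (F c) c N)
    ≡⟨ Σℤ-divisors-mono N F 1≤N ⟩
  (if does (N ∣? N) then F N else + 0)
    ≡⟨ if-cong (dec-true (N ∣? N) ∣-refl) ⟩
  F N ∎
  where
  open ≡-Reasoning
  collapse : ∀ {c} → c ∣ N → Σℤ (divisors (quot N c)) μ ℤ.* F c ≡ mono (F c) c N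
  collapse {c} c∣N = begin
    Σℤ (divisors (quot N c)) μ ℤ.* F c
      ≡⟨ cong (ℤ._* F c) (Σℤ-divisors-μ (quot-pos 1≤N c∣N)) ⟩
    (if does (quot N c ≟ 1) then + 1 else + 0) ℤ.* F c
      ≡⟨ if-float (ℤ._* F c) (does (quot N c ≟ 1)) ⟩
    (if does (quot N c ≟ 1) then + 1 ℤ.* F c else + 0 ℤ.* F c)
      ≡⟨ if-cong₂ _ (ℤ.*-identityˡ (F c)) (ℤ.*-zeroˡ (F c)) ⟩
    (if does (quot N c ≟ 1) then F c else + 0)
      ≡⟨ if-cong (does-⇔ (quot≡1⇔≡ 1≤N c∣N) (quot N c ≟ 1) (c ≟ N)) ⟩
    mono (F c) c N ∎

-- Coefficients of the series

φ-coefficient : ∀ t {d} j → 1 ≤ d → φ t d j ≡ (if does (j ∣? d) then μ (quot d j) ℤ.* + (j ℕ.^ t) else + 0)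
φ-coefficient t {d} j = Σℤ-divisors-mono j (λ x → μ (quot d x) ℤ.* + (x ℕ.^ t))

*-φ-coefficient : ∀ a t {d} j → 1 ≤ d →
                  a ℤ.* φ t d j ≡ (if does (j ∣? d) then a ℤ.* (μ (quot d j) ℤ.* + (j ℕ.^ t)) else + 0)
*-φ-coefficient a t {d} j 1≤d = begin
  a ℤ.* φ t d j
    ≡⟨ cong (a ℤ.*_) (φ-coefficient t j 1≤d) ⟩
  a ℤ.* (if does (j ∣? d) then μ (quot d j) ℤ.* + (j ℕ.^ t) else + 0)
    ≡⟨ if-float (a ℤ.*_) (does (j ∣? d)) ⟩
  (if does (j ∣? d) then a ℤ.* (μ (quot d j) ℤ.* + (j ℕ.^ t)) else a ℤ.* + 0)
    ≡⟨ if-cong-else (does (j ∣? d)) (ℤ.*-zeroʳ a) ⟩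
  (if does (j ∣? d) then a ℤ.* (μ (quot d j) ℤ.* + (j ℕ.^ t)) else + 0) ∎
  where open ≡-Reasoning

Σℤ-divisors-summatory-φ : ∀ {n} t (F : ℕ → ℤ) j → 1 ≤ n →
  Σℤ (divisors n) (λ d → Σℤ (divisors (quot n d)) F ℤ.* φ t d j)
  ≡ (if does (j ∣? n) then F (quot n j) ℤ.* + (j ℕ.^ t) else + 0)
Σℤ-divisors-summatory-φ {n} t F j 1≤n = by-cases (j ∣? n)
  where
  open ≡-Reasoning
  S : ℕ → ℤ
  S m = Σℤ (divisors m) F
  w : ℤ
  w = + (j ℕ.^ t)
  by-cases : (j∣?n : Dec (j ∣ n)) →
    Σℤ (divisors n) (λ d → S (quot n d) ℤ.* φ t d j) ≡ (if does j∣?n then F (quot n j) ℤ.* w else + 0)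
  by-cases (yes j∣n) = begin
    Σℤ (divisors n) (λ d → S (quot n d) ℤ.* φ t d j)
      ≡⟨ Σℤ-divisors-cong n (λ d d∣n → *-φ-coefficient (S (quot n d)) t j (divisor-pos 1≤n d∣n)) ⟩
    Σℤ (divisors n) (λ d → if does (j ∣? d) then S (quot n d) ℤ.* (μ (quot d j) ℤ.* w) else + 0)
      ≡⟨ Σℤ-divisors-multiples (λ d → S (quot n d) ℤ.* (μ (quot d j) ℤ.* w)) 1≤n j∣n ⟩
    Σℤ (divisors N) (λ u → S (quot n (j ℕ.* u)) ℤ.* (μ (quot (j ℕ.* u) j) ℤ.* w))
      ≡⟨ Σℤ-divisors-cong N (λ u u∣N → substitute u∣N) ⟩
    Σℤ (divisors N) (λ u → μ u ℤ.* S (quot N u) ℤ.* w)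
      ≡⟨ Σℤ-*ʳ (divisors N) w (λ u → μ u ℤ.* S (quot N u)) ⟩
    Σℤ (divisors N) (λ u → μ u ℤ.* S (quot N u)) ℤ.* w
      ≡⟨ cong (ℤ._* w) (möbius-inversion F (quot-pos 1≤n j∣n)) ⟩
    F N ℤ.* w ∎
    where
    open import Algebra.Properties.CommutativeSemigroup ℤ.*-commutativeSemigroup using (x∙yz≈yx∙z)
    N : ℕ
    N = quot n j
    quot[ju,j]≡u : ∀ u → quot (j ℕ.* u) j ≡ u
    quot[ju,j]≡u u = trans (cong (λ m → quot m j) (ℕ.*-comm j u)) (quot-* u (divisor-pos 1≤n j∣n))
    substitute : ∀ {u} → u ∣ N →
                 S (quot n (j ℕ.* u)) ℤ.* (μ (quot (j ℕ.* u) j) ℤ.* w) ≡ μ u ℤ.* S (quot N u) ℤ.* w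
    substitute {u} u∣N = begin
      S (quot n (j ℕ.* u)) ℤ.* (μ (quot (j ℕ.* u) j) ℤ.* w)
        ≡⟨ cong₂ (λ a b → S a ℤ.* (μ b ℤ.* w)) (quot-*-quot 1≤n j∣n u∣N) (quot[ju,j]≡u u) ⟩
      S (quot N u) ℤ.* (μ u ℤ.* w)
        ≡⟨ x∙yz≈yx∙z (S (quot N u)) (μ u) w ⟩
      μ u ℤ.* S (quot N u) ℤ.* w ∎
  by-cases (no j∤n) = Σℤ-divisors-vanish n λ d d∣n → begin
    S (quot n d) ℤ.* φ t d j
      ≡⟨ *-φ-coefficient (S (quot n d)) t j (divisor-pos 1≤n d∣n) ⟩
    (if does (j ∣? d) then S (quot n d) ℤ.* (μ (quot d j) ℤ.* w) else + 0)
      ≡⟨ if-cong (dec-false (j ∣? d) λ j∣d → j∤n (∣-trans j∣d d∣n)) ⟩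
    + 0 ∎

Mseries≡Eseries : ∀ {n} e j → 1 ≤ n → Mseries n e j ≡ Eseries n e j
Mseries≡Eseries {n} e j 1≤n = begin
  Mseries n e j
    ≡⟨ Σℤ-divisors-cong n (λ d d∣n →
         cong (λ m → Σℤ (divisors m) F ℤ.* φ 0 d j) (m∣n⇒gcd[m,n]≡m (quot-∣ 1≤n d∣n))) ⟩
  Σℤ (divisors n) (λ d → Σℤ (divisors (quot n d)) F ℤ.* φ 0 d j)
    ≡⟨ Σℤ-divisors-summatory-φ 0 F j 1≤n ⟩
  (if does (j ∣? n) then F (quot n j) ℤ.* + 1 else + 0)
    ≡⟨ coefficient (j ∣? n) ⟩
  (if does (j ∣? n) then e j else + 0)
    ≡⟨ Σℤ-divisors-mono j e 1≤n ⟨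
  Eseries n e j ∎
  where
  open ≡-Reasoning
  F : ℕ → ℤ
  F c = e (quot n c)
  coefficient : (j∣?n : Dec (j ∣ n)) →
                (if does j∣?n then F (quot n j) ℤ.* + 1 else + 0) ≡ (if does j∣?n then e j else + 0)
  coefficient (yes j∣n) = trans (ℤ.*-identityʳ _) (cong e (quot-quot 1≤n j∣n))
  coefficient (no  _)   = refl

Pseries≡n*E'series : ∀ {n} e j → 1 ≤ n → Pseries n e j ≡ + n ℤ.* E'series n e j
Pseries≡n*E'series {n} e j 1≤n = begin
  Pseries n e j
    ≡⟨ Σℤ-divisors-cong n (λ d d∣n →
         cong (λ m → Σℤ (divisors m) F ℤ.* φ 2 d j) (m∣n⇒gcd[m,n]≡m (quot-∣ 1≤n d∣n))) ⟩
  Σℤ (divisors n) (λ d → Σℤ (divisors (quot n d)) F ℤ.* φ 2 d j)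
    ≡⟨ Σℤ-divisors-summatory-φ 2 F j 1≤n ⟩
  (if does (j ∣? n) then F (quot n j) ℤ.* + (j ℕ.^ 2) else + 0)
    ≡⟨ coefficient (j ∣? n) ⟩
  + n ℤ.* (if does (j ∣? n) then + j ℤ.* e (quot n j) else + 0)
    ≡⟨ cong (+ n ℤ.*_) (Σℤ-divisors-mono j (λ d → + d ℤ.* e (quot n d)) 1≤n) ⟨
  + n ℤ.* E'series n e j ∎
  where
  open ≡-Reasoning
  F : ℕ → ℤ
  F c = + c ℤ.* e c
  coefficient : (j∣?n : Dec (j ∣ n)) →
    (if does j∣?n then F (quot n j) ℤ.* + (j ℕ.^ 2) else + 0)
    ≡ + n ℤ.* (if does j∣?n then + j ℤ.* e (quot n j) else + 0)
  coefficient (no _) = sym (ℤ.*-zeroʳ (+ n))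
  coefficient (yes j∣n@(divides N refl)) = begin
    (+ quot n j ℤ.* e (quot n j)) ℤ.* + (j ℕ.^ 2) ≡⟨ cong (λ q → (+ q ℤ.* e q) ℤ.* + (j ℕ.^ 2)) N≡ ⟩
    (+ N ℤ.* e N) ℤ.* + (j ℕ.^ 2)                 ≡⟨ cong ((+ N ℤ.* e N) ℤ.*_) j^2≡j*j ⟩
    (+ N ℤ.* e N) ℤ.* (+ j ℤ.* + j)               ≡⟨ rearrange (+ N) (+ j) (e N) ⟩
    (+ N ℤ.* + j) ℤ.* (+ j ℤ.* e N)               ≡⟨ cong₂ (λ a q → a ℤ.* (+ j ℤ.* e q))
                                                             (ℤ.pos-* N j) N≡ ⟨
    + n ℤ.* (+ j ℤ.* e (quot n j))                ∎
    where
    open import Data.Integer.Solver using (module +-*-Solver)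
    open +-*-Solver
    N≡ : quot n j ≡ N
    N≡ = quot-* N (divisor-pos 1≤n j∣n)
    j^2≡j*j : + (j ℕ.^ 2) ≡ + j ℤ.* + j
    j^2≡j*j = trans (cong (λ k → + (j ℕ.* k)) (ℕ.*-identityʳ j)) (ℤ.pos-* j j)
    rearrange : ∀ a b c → (a ℤ.* c) ℤ.* (b ℤ.* b) ≡ (a ℤ.* b) ℤ.* (b ℤ.* c)
    rearrange = solve 3 (λ a b c → (a :* c) :* (b :* b) := (a :* b) :* (b :* c)) refl

-- Transfer to a commutative ring

module _ {c ℓ : Level} (R : CommutativeRing c ℓ) where
  open CommutativeRing R renaming (refl to ≈-refl; sym to ≈-sym; trans to ≈-trans)
  open import Algebra.Properties.Semiring.Mult semiring using (×1-homo-*) renaming (_×_ to _·_)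
  open import Algebra.Properties.Ring ring using (-‿distribʳ-*; -0#≈0#)
  open import Algebra.Properties.CommutativeSemigroup *-commutativeSemigroup using (x∙yz≈y∙xz)
  open import Relation.Binary.Reasoning.Setoid setoid

  ℕtoR≡·1# : ∀ k → ℕtoR R k ≡ k · 1#
  ℕtoR≡·1# zero    = refl
  ℕtoR≡·1# (suc k) = cong (_+_ 1#) (ℕtoR≡·1# k)

  ℕtoR-* : ∀ m k → ℕtoR R (m ℕ.* k) ≈ ℕtoR R m * ℕtoR R k
  ℕtoR-* m k = begin
    ℕtoR R (m ℕ.* k)    ≡⟨ ℕtoR≡·1# (m ℕ.* k) ⟩
    (m ℕ.* k) · 1#      ≈⟨ ×1-homo-* m k ⟩
    (m · 1#) * (k · 1#) ≡⟨ cong₂ _*_ (ℕtoR≡·1# m) (ℕtoR≡·1# k) ⟨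
    ℕtoR R m * ℕtoR R k ∎

  ℤtoR-neg : ∀ k → ℤtoR R (ℤ.- + k) ≈ - ℕtoR R k
  ℤtoR-neg zero    = ≈-sym -0#≈0#
  ℤtoR-neg (suc k) = ≈-refl

  ℤtoR-+* : ∀ n z → ℤtoR R (+ n ℤ.* z) ≈ ℕtoR R n * ℤtoR R z
  ℤtoR-+* n (+ m) = begin
    ℤtoR R (+ n ℤ.* + m) ≡⟨ cong (ℤtoR R) (ℤ.pos-* n m) ⟨
    ℕtoR R (n ℕ.* m)     ≈⟨ ℕtoR-* n m ⟩
    ℕtoR R n * ℕtoR R m  ∎
  ℤtoR-+* n -[1+ m ] = begin
    ℤtoR R (+ n ℤ.* -[1+ m ])     ≡⟨ cong (ℤtoR R) -[n*suc[m]]≡ ⟨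
    ℤtoR R (ℤ.- + (n ℕ.* suc m))  ≈⟨ ℤtoR-neg (n ℕ.* suc m) ⟩
    - ℕtoR R (n ℕ.* suc m)        ≈⟨ -‿cong (ℕtoR-* n (suc m)) ⟩
    - (ℕtoR R n * ℕtoR R (suc m)) ≈⟨ -‿distribʳ-* _ _ ⟩
    ℕtoR R n * ℤtoR R -[1+ m ]    ∎
    where
    -[n*suc[m]]≡ : ℤ.- + (n ℕ.* suc m) ≡ + n ℤ.* -[1+ m ]
    -[n*suc[m]]≡ = trans (cong ℤ.-_ (ℤ.pos-* n (suc m))) (ℤ.neg-distribʳ-* (+ n) (+ suc m))

  ℤtoR-+*-cancel : ∀ {n ninv} → ℕtoR R n * ninv ≈ 1# → ∀ z → ninv * ℤtoR R (+ n ℤ.* z) ≈ ℤtoR R z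
  ℤtoR-+*-cancel {n} {ninv} n*ninv≈1 z = begin
    ninv * ℤtoR R (+ n ℤ.* z)    ≈⟨ *-congˡ (ℤtoR-+* n z) ⟩
    ninv * (ℕtoR R n * ℤtoR R z) ≈⟨ *-assoc ninv _ _ ⟨
    (ninv * ℕtoR R n) * ℤtoR R z ≈⟨ *-congʳ (≈-trans (*-comm ninv _) n*ninv≈1) ⟩
    1# * ℤtoR R z                ≈⟨ *-identityˡ _ ⟩
    ℤtoR R z                     ∎

  ΣR-cong : ∀ xs {f g} → (∀ x → f x ≈ g x) → ΣR R xs f ≈ ΣR R xs g
  ΣR-cong []       f≈g = ≈-refl
  ΣR-cong (x ∷ xs) f≈g = +-cong (f≈g x) (ΣR-cong xs f≈g)

  *-distribˡ-ΣR : ∀ a xs f → a * ΣR R xs f ≈ ΣR R xs (λ x → a * f x)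
  *-distribˡ-ΣR a []       f = zeroʳ a
  *-distribˡ-ΣR a (x ∷ xs) f = ≈-trans (distribˡ a _ _) (+-congˡ (*-distribˡ-ΣR a xs f))

  ⋆-congʳ : ∀ f {g h} → (∀ j → g j ≈ h j) → ∀ k → _⋆_ R f g k ≈ _⋆_ R f h k
  ⋆-congʳ f g≈h k = ΣR-cong (divisors k) (λ d → *-congˡ (g≈h (quot k d)))

  *-distribˡ-⋆ : ∀ a f g k → a * _⋆_ R f g k ≈ _⋆_ R f (λ j → a * g j) k
  *-distribˡ-⋆ a f g k = ≈-trans (*-distribˡ-ΣR a (divisors k) _)
                                 (ΣR-cong (divisors k) (λ d → x∙yz≈y∙xz a (f d) (g (quot k d))))

mainTheorem8 : ∀ {c ℓ : Level} (R : CommutativeRing c ℓ) →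
    let open CommutativeRing R in
    (n : ℕ) → 1 ≤ n → (e : ℕ → ℤ) →
    (ninv : Carrier) → ℕtoR R n * ninv ≈ 1# →
    (G : DS Carrier) → (mstar pstar : DS Carrier) →
    (∀ k → 1 ≤ k → mstar k ≈ _⋆_ R G (lift R (Eseries n e)) k) →
    (∀ k → 1 ≤ k → pstar k ≈ _⋆_ R G (lift R (E'series n e)) k) →
    (∀ k → 1 ≤ k → _⋆_ R G (lift R (Mseries n e)) k ≈ mstar k)
    × (∀ k → 1 ≤ k → ninv * _⋆_ R G (lift R (Pseries n e)) k ≈ pstar k)
mainTheorem8 R n 1≤n e ninv n*ninv≈1 G mstar pstar mstar≈ pstar≈ = M-identity , P-identity
  where
  open CommutativeRing R
  open import Relation.Binary.Reasoning.Setoid setoid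
  M-identity : ∀ k → 1 ≤ k → _⋆_ R G (lift R (Mseries n e)) k ≈ mstar k
  M-identity k 1≤k = begin
    _⋆_ R G (lift R (Mseries n e)) k ≈⟨ ⋆-congʳ R G (λ j → reflexive (cong (ℤtoR R) (Mseries≡Eseries e j 1≤n))) k ⟩
    _⋆_ R G (lift R (Eseries n e)) k ≈⟨ mstar≈ k 1≤k ⟨
    mstar k                          ∎
  P-identity : ∀ k → 1 ≤ k → ninv * _⋆_ R G (lift R (Pseries n e)) k ≈ pstar k
  P-identity k 1≤k = begin
    ninv * _⋆_ R G (lift R (Pseries n e)) k         ≈⟨ *-distribˡ-⋆ R ninv G (lift R (Pseries n e)) k ⟩
    _⋆_ R G (λ j → ninv * ℤtoR R (Pseries n e j)) k ≈⟨ ⋆-congʳ R G ninv*P≈E′ k ⟩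
    _⋆_ R G (lift R (E'series n e)) k               ≈⟨ pstar≈ k 1≤k ⟨
    pstar k                                         ∎
    where
    ninv*P≈E′ : ∀ j → ninv * ℤtoR R (Pseries n e j) ≈ ℤtoR R (E'series n e j)
    ninv*P≈E′ j = begin
      ninv * ℤtoR R (Pseries n e j)          ≡⟨ cong (λ z → ninv * ℤtoR R z) (Pseries≡n*E'series e j 1≤n) ⟩
      ninv * ℤtoR R (+ n ℤ.* E'series n e j) ≈⟨ ℤtoR-+*-cancel R {n} n*ninv≈1 (E'series n e j) ⟩
      ℤtoR R (E'series n e j)                ∎
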